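{- Let $H$ and $H'$ be two vertex-disjoint global amoebas. Then their disjoint union $G=H\cup H'$ is a global amoeba.
   Context: For a graph $G$ on vertex set $V=\{v_1,\dots,v_n\}$ let $L_G=\{ij: v_iv_j\in E(G)\}$; for $\sigma\in S_n$, $G_\sigma$ is the graph on $V$ with $E(G_\sigma)=\{v_{\sigma^{ -1}(i)}v_{\sigma^{ -1}(j)}: ij\in L_G\}$. An edge-replacement $e\to e'$ ($e\in E(G)$, $e'\in E(\overline G)\cup\{e\}$) is feasible if $G-e+e'\cong G$. Let $R_G$ be the set of feasible replacements $rs\to kl$ (meaning $v_rv_s\to v_kv_l$), $S_G(rs\to kl)=\{\sigma\in S_n: G_\sigma=G-v_rv_s+v_kv_l\}$, and $S_G\le S_n$ the group generated by $\bigcup_{rs\to kl\in R_G}S_G(rs\to kl)$. $G$ is a local amoeba if $S_G=S_n$; $G$ is a global amoeba if there is $T\ge0$ such that $G\cup tK_1$ ($G$ plus $t$ isolated vertices) is a local amoeba for all $t\ge T$. -}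

module Defs where

open import Data.Nat using (ℕ; _+_; _≥_)
open import Data.Bool using (Bool; true; false; if_then_else_; _∧_; _∨_)
open import Data.Fin using (Fin; splitAt; _≟_)
open import Data.Fin.Permutation using (Permutation′; _⟨$⟩ʳ_; id; flip; _∘ₚ_)
open import Data.Sum using (_⊎_; inj₁; inj₂)
open import Data.Product using (_×_; _,_; ∃; Σ)
open import Relation.Nullary using (¬_; does)
open import Relation.Binary.PropositionalEquality using (_≡_; _≢_; refl)

record Graph (n : ℕ) : Set where
  field
    adj    : Fin n → Fin n → Bool
    sym    : ∀ a b → adj a b ≡ adj b a
    irrefl : ∀ a → adj a a ≡ false
open Graph public

samePair : ∀ {n} → Fin n → Fin n → Fin n → Fin n → Bool
samePair a b k l = (does (a ≟ k) ∧ does (b ≟ l)) ∨ (does (a ≟ l) ∧ does (b ≟ k))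

-- Adjacency of G - v_r v_s + v_k v_l.
replaced : ∀ {n} → Graph n → (r s k l : Fin n) → Fin n → Fin n → Bool
replaced G r s k l a b =
  if samePair a b k l then true
  else (if samePair a b r s then false else adj G a b)

-- Adjacency of G_σ : v_i v_j ∈ E(G) iff v_σ⁻¹(i) v_σ⁻¹(j) ∈ E(G_σ),
-- i.e. a b adjacent in G_σ iff σ(a) σ(b) adjacent in G.
permuted : ∀ {n} → Graph n → Permutation′ n → Fin n → Fin n → Bool
permuted G σ a b = adj G (σ ⟨$⟩ʳ a) (σ ⟨$⟩ʳ b)

-- rs → kl is an admissible replacement: v_r v_s ∈ E(G) and
-- v_k v_l ∈ E(complement of G) ∪ {v_r v_s}.
Replacement : ∀ {n} → Graph n → (r s k l : Fin n) → Set
Replacement G r s k l =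
  adj G r s ≡ true ×
  ((adj G k l ≡ false × k ≢ l) ⊎ ((k ≡ r × l ≡ s) ⊎ (k ≡ s × l ≡ r)))

-- σ ∈ S_G(rs → kl) : G_σ = G - v_r v_s + v_k v_l.
InSG : ∀ {n} → Graph n → (r s k l : Fin n) → Permutation′ n → Set
InSG G r s k l σ = ∀ a b → permuted G σ a b ≡ replaced G r s k l a b

-- σ lies in the union of the S_G(rs → kl) over feasible replacements rs → kl.
-- (Feasibility, G - e + e' ≅ G, is witnessed by σ itself.)
Generator : ∀ {n} → Graph n → Permutation′ n → Set
Generator {n} G σ =
  Σ (Fin n) λ r → Σ (Fin n) λ s → Σ (Fin n) λ k → Σ (Fin n) λ l →
    Replacement G r s k l × InSG G r s k l σ

-- The subgroup of S_n generated by a set P of permutations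
-- (permutations compared extensionally).
data Generated {n : ℕ} (P : Permutation′ n → Set) : Permutation′ n → Set where
  gen  : ∀ {σ} → P σ → Generated P σ
  one  : Generated P id
  comp : ∀ {σ τ} → Generated P σ → Generated P τ → Generated P (σ ∘ₚ τ)
  inv  : ∀ {σ} → Generated P σ → Generated P (flip σ)
  ext  : ∀ {σ τ} → Generated P σ → (∀ i → σ ⟨$⟩ʳ i ≡ τ ⟨$⟩ʳ i) → Generated P τ

LocalAmoeba : ∀ {n} → Graph n → Set
LocalAmoeba {n} G = ∀ (σ : Permutation′ n) → Generated (Generator G) σ

-- Disjoint union: vertices of H first, then those of H'.
unionAdj : ∀ {m m'} → Graph m → Graph m' → Fin m ⊎ Fin m' → Fin m ⊎ Fin m' → Bool
unionAdj H H' (inj₁ a) (inj₁ b) = adj H a b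
unionAdj H H' (inj₂ a) (inj₂ b) = adj H' a b
unionAdj H H' (inj₁ a) (inj₂ b) = false
unionAdj H H' (inj₂ a) (inj₁ b) = false

unionAdj-sym : ∀ {m m'} (H : Graph m) (H' : Graph m') x y →
  unionAdj H H' x y ≡ unionAdj H H' y x
unionAdj-sym H H' (inj₁ a) (inj₁ b) = sym H a b
unionAdj-sym H H' (inj₂ a) (inj₂ b) = sym H' a b
unionAdj-sym H H' (inj₁ a) (inj₂ b) = refl
unionAdj-sym H H' (inj₂ a) (inj₁ b) = refl

unionAdj-irrefl : ∀ {m m'} (H : Graph m) (H' : Graph m') x → unionAdj H H' x x ≡ false
unionAdj-irrefl H H' (inj₁ a) = irrefl H a
unionAdj-irrefl H H' (inj₂ a) = irrefl H' a

_∪ᴳ_ : ∀ {m m'} → Graph m → Graph m' → Graph (m + m')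
adj    (_∪ᴳ_ {m} H H') a b = unionAdj H H' (splitAt m a) (splitAt m b)
sym    (_∪ᴳ_ {m} H H') a b = unionAdj-sym H H' (splitAt m a) (splitAt m b)
irrefl (_∪ᴳ_ {m} H H') a   = unionAdj-irrefl H H' (splitAt m a)

empty : (t : ℕ) → Graph t
adj    (empty t) a b = false
sym    (empty t) a b = refl
irrefl (empty t) a   = refl

addIsolated : ∀ {n} → Graph n → (t : ℕ) → Graph (n + t)
addIsolated G t = G ∪ᴳ empty t

GlobalAmoeba : ∀ {n} → Graph n → Set
GlobalAmoeba G = ∃ λ T → ∀ t → t ≥ T → LocalAmoeba (addIsolated G t)

-- Write G_t = (H ∪ H') ∪ tK₁.  For t ≥ 1 beyond both thresholds, H ∪ tK₁ and
-- H' ∪ tK₁ are local amoebas, and G_t decomposes both as (H ∪ tK₁) ∪ H' and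
-- as (H' ∪ tK₁) ∪ H.  A feasible replacement of a graph P remains feasible
-- in P ∪ Q, realised by the same permutation extended by the identity on Q;
-- hence S_P embeds into S_{P ∪ Q}, and S_{G_t} contains every transposition
-- of two vertices of H ∪ tK₁, and of two vertices of H' ∪ tK₁.  These two
-- vertex sets cover G_t and share the isolated vertices, so any remaining
-- transposition (i j) is (i c)(c j)(i c) for an isolated vertex c.  Since
-- transpositions generate S_n, G_t is a local amoeba.
module Submission where

open import Defs hiding (sym)
open import Data.Nat using (ℕ; suc; _+_; _≥_; s≤s)
open import Data.Nat.Properties using (m+n≤o⇒m≤o; m+n≤o⇒n≤o; m≤n⇒m≤1+n)
open import Data.Bool using (Bool; false)
open import Data.Bool.Properties using (∧-zeroʳ)
open import Data.Fin as Fin using (Fin; _≟_; splitAt; join)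
open import Data.Fin.Properties using (splitAt-join; +↔⊎)
open import Data.Fin.Permutation
  using (Permutation′; _⟨$⟩ʳ_; id; flip; _∘ₚ_; transpose; _≈_)
open import Data.Fin.Permutation.Transposition.List using (eval; decompose; eval-decompose)
open import Data.List using ([]; _∷_)
open import Data.Sum using (_⊎_; inj₁; inj₂; map₁; swap)
open import Data.Sum.Properties using (inj₁-injective; map-id; map-map; map₁-cong)
open import Data.Sum.Algebra using (⊎-cong; ⊎-comm; ⊎-assoc)
open import Data.Product using (_×_; _,_; proj₁; proj₂; ∃-syntax)
open import Function using (_↔_; Inverse; Injective; _∘_; case_of_)
open import Function.Properties.Inverse using (↔-refl; ↔-sym; ↔-trans)
open import Level using (0ℓ)
open import Relation.Nullary using (yes; no; does)
open import Relation.Nullary.Decidable using (dec-true; dec-false)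
open import Relation.Binary.PropositionalEquality
  using (_≡_; _≢_; refl; sym; trans; cong; cong₂; subst; module ≡-Reasoning)

module _ {n : ℕ} where

  transpose-ˡ : (i j : Fin n) → transpose i j ⟨$⟩ʳ i ≡ j
  transpose-ˡ i j rewrite dec-true (i ≟ i) refl = refl

  transpose-ʳ : (i j : Fin n) → transpose i j ⟨$⟩ʳ j ≡ i
  transpose-ʳ i j with j ≟ i
  ... | yes j≡i = j≡i
  ... | no _ rewrite dec-true (j ≟ j) refl = refl

  transpose-other : ∀ {i j k : Fin n} → k ≢ i → k ≢ j → transpose i j ⟨$⟩ʳ k ≡ k
  transpose-other {i} {j} {k} k≢i k≢j
    rewrite dec-false (k ≟ i) k≢i | dec-false (k ≟ j) k≢j = refl

  transpose-self : (i : Fin n) → transpose i i ≈ id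
  transpose-self i k = case k ≟ i of λ where
    (yes refl) → transpose-ˡ k k
    (no k≢i)   → transpose-other k≢i k≢i

  transpose-involutive : (i j k : Fin n) → transpose i j ⟨$⟩ʳ (transpose i j ⟨$⟩ʳ k) ≡ k
  transpose-involutive i j k = case ((k ≟ i) , (k ≟ j)) of λ where
    (yes refl , _) → trans (cong (transpose k j ⟨$⟩ʳ_) (transpose-ˡ k j)) (transpose-ʳ k j)
    (no _ , yes refl) → trans (cong (transpose i k ⟨$⟩ʳ_) (transpose-ʳ i k)) (transpose-ˡ i k)
    (no k≢i , no k≢j) →
      trans (cong (transpose i j ⟨$⟩ʳ_) (transpose-other k≢i k≢j)) (transpose-other k≢i k≢j)

  transpose-injective : (i j : Fin n) → Injective _≡_ _≡_ (transpose i j ⟨$⟩ʳ_)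
  transpose-injective i j {k} {l} e = begin
    k                                             ≡⟨ sym (transpose-involutive i j k) ⟩
    transpose i j ⟨$⟩ʳ (transpose i j ⟨$⟩ʳ k)     ≡⟨ cong (transpose i j ⟨$⟩ʳ_) e ⟩
    transpose i j ⟨$⟩ʳ (transpose i j ⟨$⟩ʳ l)     ≡⟨ transpose-involutive i j l ⟩
    l                                             ∎
    where open ≡-Reasoning

-- This is both the conjugation rule below and the reason a transposition
-- of P lifts to a transposition of any graph containing P.
transpose-natural : ∀ {m n} (f : Fin m → Fin n) → Injective _≡_ _≡_ f →
  ∀ i j k → f (transpose i j ⟨$⟩ʳ k) ≡ transpose (f i) (f j) ⟨$⟩ʳ f k
transpose-natural f f-inj i j k = case ((k ≟ i) , (k ≟ j)) of λ where
  (yes refl , _) → trans (cong f (transpose-ˡ k j)) (sym (transpose-ˡ (f k) (f j)))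
  (no _ , yes refl) → trans (cong f (transpose-ʳ i k)) (sym (transpose-ʳ (f i) (f k)))
  (no k≢i , no k≢j) → trans (cong f (transpose-other k≢i k≢j))
    (sym (transpose-other (k≢i ∘ f-inj) (k≢j ∘ f-inj)))

transpose-conjugate : ∀ {n} {i j c : Fin n} → j ≢ i → j ≢ c →
  (transpose i c ∘ₚ transpose c j ∘ₚ transpose i c) ≈ transpose i j
transpose-conjugate {i = i} {j} {c} j≢i j≢c k = begin
  τ (transpose c j ⟨$⟩ʳ τ k)               ≡⟨ transpose-natural τ (transpose-injective i c) c j (τ k) ⟩
  transpose (τ c) (τ j) ⟨$⟩ʳ τ (τ k)       ≡⟨ cong₂ (λ a b → transpose a b ⟨$⟩ʳ τ (τ k))
                                                  (transpose-ʳ i c) (transpose-other j≢i j≢c) ⟩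
  transpose i j ⟨$⟩ʳ τ (τ k)               ≡⟨ cong (transpose i j ⟨$⟩ʳ_) (transpose-involutive i c k) ⟩
  transpose i j ⟨$⟩ʳ k                     ∎
  where
  open ≡-Reasoning
  τ : Fin _ → Fin _
  τ = transpose i c ⟨$⟩ʳ_

transpositions-generate : ∀ {n} {P : Permutation′ n → Set} →
  (∀ i j → Generated P (transpose i j)) → ∀ π → Generated P π
transpositions-generate {P = P} generated π = ext (product (decompose π)) (eval-decompose π)
  where
  product : ∀ ts → Generated P (eval ts)
  product []             = one
  product ((i , j) ∷ ts) = comp (generated i j) (product ts)

transpose-via : ∀ {n} {P : Permutation′ n → Set} {i c j : Fin n} →
  Generated P (transpose i c) → Generated P (transpose c j) → Generated P (transpose i j)
transpose-via {i = i} {c} {j} ic cj = case ((j ≟ i) , (j ≟ c)) of λ where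
  (yes refl , _)       → ext one (λ k → sym (transpose-self j k))
  (no _ , yes refl)    → ic
  (no j≢i , no j≢c)    → ext (comp ic (comp cj ic)) (transpose-conjugate j≢i j≢c)

record Homomorphism {K N : ℕ} (h : Permutation′ K → Permutation′ N) : Set where
  field
    preserves-id   : h id ≈ id
    preserves-∘    : ∀ σ τ → h (σ ∘ₚ τ) ≈ h σ ∘ₚ h τ
    preserves-flip : ∀ σ → h (flip σ) ≈ flip (h σ)
    preserves-≈    : ∀ {σ τ} → σ ≈ τ → h σ ≈ h τ

generated-image : ∀ {K N} {P : Permutation′ K → Set} {Q : Permutation′ N → Set}
  {h : Permutation′ K → Permutation′ N} → Homomorphism h →
  (∀ {σ} → P σ → Q (h σ)) → ∀ {σ} → Generated P σ → Generated Q (h σ)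
generated-image {P = P} {Q} {h} hom gens = image
  where
  open Homomorphism hom
  image : ∀ {σ} → Generated P σ → Generated Q (h σ)
  image (gen p)    = gen (gens p)
  image one        = ext one (λ k → sym (preserves-id k))
  image (comp g f) = ext (comp (image g) (image f)) (λ k → sym (preserves-∘ _ _ k))
  image (inv g)    = ext (inv (image g)) (λ k → sym (preserves-flip _ k))
  image (ext g e)  = ext (image g) (preserves-≈ e)

≟-injective : ∀ {m n} (f : Fin m → Fin n) → Injective _≡_ _≡_ f →
  ∀ a b → does (f a ≟ f b) ≡ does (a ≟ b)
≟-injective f f-inj a b with a ≟ b
... | yes refl = dec-true (f a ≟ f a) refl
... | no a≢b   = dec-false (f a ≟ f b) (a≢b ∘ f-inj)

samePair-injective : ∀ {m n} (f : Fin m → Fin n) → Injective _≡_ _≡_ f →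
  ∀ a b k l → samePair (f a) (f b) (f k) (f l) ≡ samePair a b k l
samePair-injective f f-inj a b k l
  rewrite ≟-injective f f-inj a k | ≟-injective f f-inj a l
        | ≟-injective f f-inj b k | ≟-injective f f-inj b l = refl

samePair-awayˡ : ∀ {n} {a k l : Fin n} (b : Fin n) → a ≢ k → a ≢ l → samePair a b k l ≡ false
samePair-awayˡ {a = a} {k} {l} b a≢k a≢l
  rewrite dec-false (a ≟ k) a≢k | dec-false (a ≟ l) a≢l = refl

samePair-awayʳ : ∀ {n} {b k l : Fin n} (a : Fin n) → b ≢ k → b ≢ l → samePair a b k l ≡ false
samePair-awayʳ {b = b} {k} {l} a b≢k b≢l
  rewrite dec-false (b ≟ k) b≢k | dec-false (b ≟ l) b≢l
        | ∧-zeroʳ (does (a ≟ k)) | ∧-zeroʳ (does (a ≟ l)) = refl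

replaced-unchanged : ∀ {n} (G : Graph n) {r s k l a b : Fin n} →
  samePair a b k l ≡ false → samePair a b r s ≡ false → replaced G r s k l a b ≡ adj G a b
replaced-unchanged G kl≢ab rs≢ab rewrite kl≢ab | rs≢ab = refl

replaced-embedding : ∀ {m n} (P : Graph m) (G : Graph n) (f : Fin m → Fin n) →
  Injective _≡_ _≡_ f → (∀ x y → adj G (f x) (f y) ≡ adj P x y) →
  ∀ r s k l a b → replaced G (f r) (f s) (f k) (f l) (f a) (f b) ≡ replaced P r s k l a b
replaced-embedding P G f f-inj f-adj r s k l a b
  rewrite samePair-injective f f-inj a b k l | samePair-injective f f-inj a b r s
        | f-adj a b = refl

replacement-embedding : ∀ {m n} (P : Graph m) (G : Graph n) (f : Fin m → Fin n) →
  Injective _≡_ _≡_ f → (∀ x y → adj G (f x) (f y) ≡ adj P x y) →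
  ∀ {r s k l} → Replacement P r s k l → Replacement G (f r) (f s) (f k) (f l)
replacement-embedding P G f f-inj f-adj {r} {s} {k} {l} (rs∈P , inj₁ (kl∉P , k≢l)) =
  trans (f-adj r s) rs∈P , inj₁ (trans (f-adj k l) kl∉P , k≢l ∘ f-inj)
replacement-embedding P G f f-inj f-adj {r} {s} (rs∈P , inj₂ (inj₁ (refl , refl))) =
  trans (f-adj r s) rs∈P , inj₂ (inj₁ (refl , refl))
replacement-embedding P G f f-inj f-adj {r} {s} (rs∈P , inj₂ (inj₂ (refl , refl))) =
  trans (f-adj r s) rs∈P , inj₂ (inj₂ (refl , refl))

record Decomposition {N K R : ℕ} (G : Graph N) (P : Graph K) (Q : Graph R) : Set where
  field
    relabel   : Fin N ↔ (Fin K ⊎ Fin R)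
    preserves : ∀ u v → adj G (Inverse.from relabel u) (Inverse.from relabel v) ≡ unionAdj P Q u v

module Lifting {N K R : ℕ} {G : Graph N} {P : Graph K} {Q : Graph R}
               (D : Decomposition G P Q) where
  open Decomposition D

  label : Fin N → Fin K ⊎ Fin R
  label = Inverse.to relabel

  vertex : Fin K ⊎ Fin R → Fin N
  vertex = Inverse.from relabel

  vertex-label : ∀ x → vertex (label x) ≡ x
  vertex-label = Inverse.strictlyInverseʳ relabel

  label-vertex : ∀ w → label (vertex w) ≡ w
  label-vertex = Inverse.strictlyInverseˡ relabel

  by-labels : ∀ {F : Fin N → Set} → (∀ w → F (vertex w)) → ∀ x → F x
  by-labels {F} h x = subst F (vertex-label x) (h (label x))

  vertex-injective : Injective _≡_ _≡_ vertex
  vertex-injective {w} {w′} e = trans (sym (label-vertex w)) (trans (cong label e) (label-vertex w′))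

  embed : Fin K → Fin N
  embed u = vertex (inj₁ u)

  embed-injective : Injective _≡_ _≡_ embed
  embed-injective = inj₁-injective ∘ vertex-injective

  embed-adj : ∀ x y → adj G (embed x) (embed y) ≡ adj P x y
  embed-adj x y = preserves (inj₁ x) (inj₁ y)

  outside≢embed : ∀ y u → vertex (inj₂ y) ≢ embed u
  outside≢embed y u e with vertex-injective e
  ... | ()

  InFirstPart : Fin N → Set
  InFirstPart x = ∃[ u ] label x ≡ inj₁ u

  embed-label : ∀ {x u} → label x ≡ inj₁ u → embed u ≡ x
  embed-label {x} e = trans (cong vertex (sym e)) (vertex-label x)

  lift : Permutation′ K → Permutation′ N
  lift σ = ↔-trans relabel (↔-trans (⊎-cong σ ↔-refl) (↔-sym relabel))

  lift-vertex : ∀ σ w → lift σ ⟨$⟩ʳ vertex w ≡ vertex (map₁ (σ ⟨$⟩ʳ_) w)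
  lift-vertex σ w = cong (vertex ∘ map₁ (σ ⟨$⟩ʳ_)) (label-vertex w)

  lift-homomorphism : Homomorphism lift
  lift-homomorphism = record
    { preserves-id   = λ x → trans (cong vertex (map-id (label x))) (vertex-label x)
    ; preserves-∘    = λ σ τ x → sym (trans (cong (vertex ∘ map₁ (τ ⟨$⟩ʳ_)) (label-vertex _))
                                           (cong vertex (map-map (label x))))
    ; preserves-flip = λ σ x → refl
    ; preserves-≈    = λ e x → cong vertex (map₁-cong e (label x))
    }

  lift-transpose : ∀ u v → lift (transpose u v) ≈ transpose (embed u) (embed v)
  lift-transpose u v = by-labels on-label
    where
    on-label : ∀ w → lift (transpose u v) ⟨$⟩ʳ vertex w ≡ transpose (embed u) (embed v) ⟨$⟩ʳ vertex w
    on-label (inj₁ y) = trans (lift-vertex (transpose u v) (inj₁ y))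
                              (transpose-natural embed embed-injective u v y)
    on-label (inj₂ y) = trans (lift-vertex (transpose u v) (inj₂ y))
                              (sym (transpose-other (outside≢embed y u) (outside≢embed y v)))

  lift-generator : ∀ {σ} → Generator P σ → Generator G (lift σ)
  lift-generator {σ} (r , s , k , l , feasible , σ-replaces) =
    embed r , embed s , embed k , embed l ,
    replacement-embedding P G embed embed-injective embed-adj feasible ,
    by-labels {F = λ a → ∀ b → permuted G (lift σ) a b ≡ G′ a b}
      (λ w → by-labels (on-labels w))
    where
    open ≡-Reasoning
    σ⁺ : Fin K ⊎ Fin R → Fin K ⊎ Fin R
    σ⁺ = map₁ (σ ⟨$⟩ʳ_)

    G′ : Fin N → Fin N → Bool
    G′ = replaced G (embed r) (embed s) (embed k) (embed l)

    moved : ∀ w w′ → permuted G (lift σ) (vertex w) (vertex w′) ≡ unionAdj P Q (σ⁺ w) (σ⁺ w′)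
    moved w w′ = trans (cong₂ (adj G) (lift-vertex σ w) (lift-vertex σ w′)) (preserves (σ⁺ w) (σ⁺ w′))

    untouched : ∀ w w′ →
      samePair (vertex w) (vertex w′) (embed k) (embed l) ≡ false →
      samePair (vertex w) (vertex w′) (embed r) (embed s) ≡ false →
      unionAdj P Q (σ⁺ w) (σ⁺ w′) ≡ unionAdj P Q w w′ →
      permuted G (lift σ) (vertex w) (vertex w′) ≡ G′ (vertex w) (vertex w′)
    untouched w w′ kl rs fixed = begin
      permuted G (lift σ) (vertex w) (vertex w′) ≡⟨ moved w w′ ⟩
      unionAdj P Q (σ⁺ w) (σ⁺ w′)                 ≡⟨ fixed ⟩
      unionAdj P Q w w′                           ≡⟨ sym (preserves w w′) ⟩
      adj G (vertex w) (vertex w′)                ≡⟨ sym (replaced-unchanged G kl rs) ⟩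
      G′ (vertex w) (vertex w′)                   ∎

    on-labels : ∀ w w′ → permuted G (lift σ) (vertex w) (vertex w′) ≡ G′ (vertex w) (vertex w′)
    on-labels (inj₁ x) (inj₁ y) = begin
      permuted G (lift σ) (embed x) (embed y) ≡⟨ moved (inj₁ x) (inj₁ y) ⟩
      adj P (σ ⟨$⟩ʳ x) (σ ⟨$⟩ʳ y)             ≡⟨ σ-replaces x y ⟩
      replaced P r s k l x y                  ≡⟨ sym (replaced-embedding P G embed embed-injective embed-adj r s k l x y) ⟩
      G′ (embed x) (embed y)                  ∎
    on-labels (inj₁ x) (inj₂ y) = untouched (inj₁ x) (inj₂ y)
      (samePair-awayʳ (embed x) (outside≢embed y k) (outside≢embed y l))
      (samePair-awayʳ (embed x) (outside≢embed y r) (outside≢embed y s)) refl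
    on-labels (inj₂ y) w′ = untouched (inj₂ y) w′
      (samePair-awayˡ (vertex w′) (outside≢embed y k) (outside≢embed y l))
      (samePair-awayˡ (vertex w′) (outside≢embed y r) (outside≢embed y s)) (fixed w′)
      where
      fixed : ∀ w′ → unionAdj P Q (inj₂ y) (σ⁺ w′) ≡ unionAdj P Q (inj₂ y) w′
      fixed (inj₁ _) = refl
      fixed (inj₂ _) = refl

  transpose-within : LocalAmoeba P → ∀ {i j} → InFirstPart i → InFirstPart j →
    Generated (Generator G) (transpose i j)
  transpose-within amoeba {i} {j} (u , i↦u) (v , j↦v) =
    ext (generated-image lift-homomorphism (λ {σ} → lift-generator {σ}) (amoeba (transpose u v)))
        (λ x → trans (lift-transpose u v x)
                     (cong₂ (λ a b → transpose a b ⟨$⟩ʳ x) (embed-label i↦u) (embed-label j↦v)))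

open Lifting using (InFirstPart; transpose-within)

glue : ∀ {N K₁ R₁ K₂ R₂} {G : Graph N} {P₁ : Graph K₁} {Q₁ : Graph R₁}
  {P₂ : Graph K₂} {Q₂ : Graph R₂}
  (D₁ : Decomposition G P₁ Q₁) (D₂ : Decomposition G P₂ Q₂) →
  LocalAmoeba P₁ → LocalAmoeba P₂ →
  (∀ x → InFirstPart D₁ x ⊎ InFirstPart D₂ x) →
  ∀ {c} → InFirstPart D₁ c → InFirstPart D₂ c → LocalAmoeba G
glue {G = G} D₁ D₂ amoeba₁ amoeba₂ cover c₁ c₂ = transpositions-generate transposition
  where
  transposition : ∀ i j → Generated (Generator G) (transpose i j)
  transposition i j with cover i | cover j
  ... | inj₁ i₁ | inj₁ j₁ = transpose-within D₁ amoeba₁ i₁ j₁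
  ... | inj₂ i₂ | inj₂ j₂ = transpose-within D₂ amoeba₂ i₂ j₂
  ... | inj₁ i₁ | inj₂ j₂ = transpose-via (transpose-within D₁ amoeba₁ i₁ c₁)
                                          (transpose-within D₂ amoeba₂ c₂ j₂)
  ... | inj₂ i₂ | inj₁ j₁ = transpose-via (transpose-within D₂ amoeba₂ i₂ c₂)
                                          (transpose-within D₁ amoeba₁ c₁ j₁)

union-join : ∀ {a b} (X : Graph a) (Y : Graph b) w w′ →
  adj (X ∪ᴳ Y) (join a b w) (join a b w′) ≡ unionAdj X Y w w′
union-join {a} {b} X Y w w′ rewrite splitAt-join a b w | splitAt-join a b w′ = refl

module Labels {a b s : ℕ} (X : Graph a) (Y : Graph b) where

  tripartition : Fin ((a + b) + s) ↔ ((Fin a ⊎ Fin b) ⊎ Fin s)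
  tripartition = ↔-trans +↔⊎ (⊎-cong +↔⊎ ↔-refl)

  labelledAdj : (Fin a ⊎ Fin b) ⊎ Fin s → (Fin a ⊎ Fin b) ⊎ Fin s → Bool
  labelledAdj (inj₁ w) (inj₁ w′) = unionAdj X Y w w′
  labelledAdj _        _         = false

  tripartition-adj : ∀ t t′ → adj ((X ∪ᴳ Y) ∪ᴳ empty s)
    (Inverse.from tripartition t) (Inverse.from tripartition t′) ≡ labelledAdj t t′
  tripartition-adj (inj₁ w) (inj₁ w′) =
    trans (union-join (X ∪ᴳ Y) (empty s) (inj₁ _) (inj₁ _)) (union-join X Y w w′)
  tripartition-adj (inj₁ w) (inj₂ c)  = union-join (X ∪ᴳ Y) (empty s) (inj₁ _) (inj₂ c)
  tripartition-adj (inj₂ c) (inj₁ w′) = union-join (X ∪ᴳ Y) (empty s) (inj₂ c) (inj₁ _)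
  tripartition-adj (inj₂ c) (inj₂ c′) = union-join (X ∪ᴳ Y) (empty s) (inj₂ c) (inj₂ c′)

  regroup : ((Fin a ⊎ Fin b) ⊎ Fin s) ↔ (Fin (a + s) ⊎ Fin b)
  regroup = ↔-trans (⊎-assoc 0ℓ _ _ _) (↔-trans (⊎-cong ↔-refl (⊎-comm _ _))
              (↔-trans (↔-sym (⊎-assoc 0ℓ _ _ _)) (⊎-cong (↔-sym +↔⊎) ↔-refl)))

  regroup-adj : ∀ u v → labelledAdj (Inverse.from regroup u) (Inverse.from regroup v)
                      ≡ unionAdj (addIsolated X s) Y u v
  regroup-adj (inj₁ z) (inj₁ z′) with splitAt a z | splitAt a z′
  ... | inj₁ _ | inj₁ _ = refl
  ... | inj₁ _ | inj₂ _ = refl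
  ... | inj₂ _ | inj₁ _ = refl
  ... | inj₂ _ | inj₂ _ = refl
  regroup-adj (inj₁ z) (inj₂ y) with splitAt a z
  ... | inj₁ _ = refl
  ... | inj₂ _ = refl
  regroup-adj (inj₂ y) (inj₁ z) with splitAt a z
  ... | inj₁ _ = refl
  ... | inj₂ _ = refl
  regroup-adj (inj₂ y) (inj₂ y′) = refl

open Labels using (tripartition; labelledAdj; tripartition-adj; regroup; regroup-adj)

labelledAdj-swap : ∀ {a b s} (X : Graph a) (Y : Graph b) (t t′ : (Fin b ⊎ Fin a) ⊎ Fin s) →
  labelledAdj X Y (map₁ swap t) (map₁ swap t′) ≡ labelledAdj Y X t t′
labelledAdj-swap X Y (inj₁ (inj₁ _)) (inj₁ (inj₁ _)) = refl
labelledAdj-swap X Y (inj₁ (inj₁ _)) (inj₁ (inj₂ _)) = refl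
labelledAdj-swap X Y (inj₁ (inj₂ _)) (inj₁ (inj₁ _)) = refl
labelledAdj-swap X Y (inj₁ (inj₂ _)) (inj₁ (inj₂ _)) = refl
labelledAdj-swap X Y (inj₁ _)        (inj₂ _)        = refl
labelledAdj-swap X Y (inj₂ _)        _               = refl

isolated-with-first : ∀ {a b s} (X : Graph a) (Y : Graph b) →
  Decomposition ((X ∪ᴳ Y) ∪ᴳ empty s) (addIsolated X s) Y
isolated-with-first {a} {b} {s} X Y = record
  { relabel   = ↔-trans (tripartition X Y) (regroup X Y)
  ; preserves = λ u v → trans (tripartition-adj X Y (ungroup u) (ungroup v)) (regroup-adj X Y u v)
  }
  where
  ungroup : Fin (a + s) ⊎ Fin b → (Fin a ⊎ Fin b) ⊎ Fin s
  ungroup = Inverse.from (regroup X Y)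

isolated-with-second : ∀ {a b s} (X : Graph a) (Y : Graph b) →
  Decomposition ((X ∪ᴳ Y) ∪ᴳ empty s) (addIsolated Y s) X
isolated-with-second {a} {b} {s} X Y = record
  { relabel   = ↔-trans (tripartition X Y) (↔-trans (⊎-cong (⊎-comm _ _) ↔-refl) (regroup Y X))
  ; preserves = λ u v → trans (tripartition-adj X Y (map₁ swap (ungroup u)) (map₁ swap (ungroup v)))
                          (trans (labelledAdj-swap X Y (ungroup u) (ungroup v)) (regroup-adj Y X u v))
  }
  where
  ungroup : Fin (b + s) ⊎ Fin a → (Fin b ⊎ Fin a) ⊎ Fin s
  ungroup = Inverse.from (regroup Y X)

-- If s ≥ 1 and X ∪ sK₁, Y ∪ sK₁ are local amoebas, so is (X ∪ Y) ∪ sK₁: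
-- the copies of X ∪ sK₁ and Y ∪ sK₁ cover it and share the isolated vertices.
union-with-isolated : ∀ {a b s} (X : Graph a) (Y : Graph b) → Fin s →
  LocalAmoeba (addIsolated X s) → LocalAmoeba (addIsolated Y s) →
  LocalAmoeba (addIsolated (X ∪ᴳ Y) s)
union-with-isolated {s = s} X Y c amoebaX amoebaY =
  glue D₁ D₂ amoebaX amoebaY cover (proj₁ isolated-vertex) (proj₂ isolated-vertex)
  where
  D₁ : Decomposition (addIsolated (X ∪ᴳ Y) s) (addIsolated X s) Y
  D₁ = isolated-with-first X Y

  D₂ : Decomposition (addIsolated (X ∪ᴳ Y) s) (addIsolated Y s) X
  D₂ = isolated-with-second X Y

  cover : ∀ x → InFirstPart D₁ x ⊎ InFirstPart D₂ x
  cover x with Inverse.to (tripartition X Y) x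
  ... | inj₁ (inj₁ _) = inj₁ (_ , refl)
  ... | inj₁ (inj₂ _) = inj₂ (_ , refl)
  ... | inj₂ _        = inj₁ (_ , refl)

  isolated-vertex : InFirstPart D₁ (Inverse.from (tripartition X Y) (inj₂ c))
                  × InFirstPart D₂ (Inverse.from (tripartition X Y) (inj₂ c))
  isolated-vertex rewrite Inverse.strictlyInverseˡ (tripartition X Y) (inj₂ c) = (_ , refl) , (_ , refl)

-- Proposition 4.1: the disjoint union of two global amoebas is a global amoeba.
-- Beyond both thresholds, and with at least one isolated vertex,
-- union-with-isolated applies.
proposition4p1 : ∀ {m m'} (H : Graph m) (H' : Graph m') →
    GlobalAmoeba H → GlobalAmoeba H' → GlobalAmoeba (H ∪ᴳ H')
proposition4p1 H H' (T , amoeba) (T′ , amoeba′) = suc (T + T′) , local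
  where
  local : ∀ t → t ≥ suc (T + T′) → LocalAmoeba (addIsolated (H ∪ᴳ H') t)
  local (suc t) (s≤s T+T′≤t) = union-with-isolated H H' Fin.zero
    (amoeba  (suc t) (m≤n⇒m≤1+n (m+n≤o⇒m≤o T T+T′≤t)))
    (amoeba′ (suc t) (m≤n⇒m≤1+n (m+n≤o⇒n≤o T T+T′≤t)))
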